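{- Let $G$ be a finite group, $C$ an inclusion-minimal generating set of $G$, and $r\ge 3$. If ${\it Cay}(G,C)$ contains a subgraph that is a subdivision of $K_{2,2}$, then ${\it Cay}(G\times R_r, C\times R_r)$ cannot be (2-cell) embedded on the torus.
   Context: A right zero semigroup is $R_r=\{r_1,\dots,r_r\}$ with multiplication $r_ir_j=r_j$; $G\times R_r$ is the direct product semigroup with $(g,r_i)(h,r_j)=(gh,r_j)$. For a semigroup $S$ and $C\subseteq S$, ${\it Cay}(S,C)$ is the simple undirected graph with vertex set $S$ in which distinct $s_1,s_2$ are adjacent iff $s_1c=s_2$ or $s_2c=s_1$ for some $c\in C$ (loops and multiple edges deleted). $K_{2,2}$ is the complete bipartite graph with parts of size $2$ (a $4$-cycle). A graph is (2-cell) embedded in a surface $M$ if it is drawn in $M$ with edges meeting only at common endpoints such that the complement of the graph in $M$ is a disjoint union of open disks. The torus is the orientable surface of genus $1$. An inclusion-minimal generating set is a generating set with no proper generating subset. -}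

module Defs where

open import Level using (0ℓ)
open import Data.Bool using (Bool; true; false; _∧_; _∨_; not; if_then_else_)
open import Data.Nat using (ℕ; zero; suc; _+_; _*_)
open import Data.Fin using (Fin)
open import Data.Product using (Σ; ∃; _×_; _,_; proj₁; proj₂)
open import Data.Product.Properties using (≡-dec)
open import Data.Sum using (_⊎_)
open import Data.List using (List; []; _∷_; _++_; [_]; length; filter; cartesianProduct; deduplicate; upTo; allFin)
open import Data.Bool.ListAction using (any)
open import Data.List.Membership.Propositional using (_∈_)
open import Data.List.Membership.Propositional.Properties using (∈-cartesianProduct⁺; ∈-allFin)
open import Data.List.Relation.Unary.All using (All)
open import Data.List.Relation.Unary.Linked using (Linked)
open import Data.List.Relation.Unary.Unique.Propositional using (Unique)
open import Relation.Nullary using (¬_; does)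
open import Relation.Binary using (DecidableEquality)
open import Relation.Binary.PropositionalEquality using (_≡_; _≢_; refl; cong₂; isEquivalence)
open import Relation.Binary.Construct.Closure.ReflexiveTransitive using (Star)
open import Algebra.Structures using (IsGroup; IsSemigroup; IsMagma)

record FiniteGroup : Set₁ where
  field
    Carrier  : Set
    _∙_      : Carrier → Carrier → Carrier
    ε        : Carrier
    _⁻¹      : Carrier → Carrier
    isGroup  : IsGroup _≡_ _∙_ ε _⁻¹
    _≟_      : DecidableEquality Carrier
    elems    : List Carrier
    complete : ∀ x → x ∈ elems

record FiniteSemigroup : Set₁ where
  field
    Carrier     : Set
    _∙_         : Carrier → Carrier → Carrier
    isSemigroup : IsSemigroup _≡_ _∙_
    _≟_         : DecidableEquality Carrier
    elems       : List Carrier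
    complete    : ∀ x → x ∈ elems

asSemigroup : FiniteGroup → FiniteSemigroup
asSemigroup G = record
  { Carrier = Carrier ; _∙_ = _∙_ ; isSemigroup = IsGroup.isSemigroup isGroup
  ; _≟_ = _≟_ ; elems = elems ; complete = complete }
  where open FiniteGroup G

-- The direct product G × R_r, R_r = Fin r the right zero semigroup:
-- (g , i) (h , j) = (g h , j)
_×R_ : FiniteGroup → ℕ → FiniteSemigroup
G ×R r = record
  { Carrier = Carrier × Fin r
  ; _∙_ = mul
  ; isSemigroup = record
      { isMagma = record { isEquivalence = isEquivalence ; ∙-cong = λ { refl refl → refl } }
      ; assoc = λ { (a , i) (b , j) (c , k) → cong₂ _,_ (IsGroup.assoc isGroup a b c) refl } }
  ; _≟_ = ≡-dec _≟_ Data.Fin._≟_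
  ; elems = cartesianProduct elems (allFin r)
  ; complete = λ { (g , i) → ∈-cartesianProduct⁺ (complete g) (∈-allFin i) } }
  where
  open FiniteGroup G
  mul : Carrier × Fin r → Carrier × Fin r → Carrier × Fin r
  mul (g , i) (h , j) = (g ∙ h , j)

module _ (G : FiniteGroup) where
  open FiniteGroup G

  evalWord : List (Bool × Carrier) → Carrier
  evalWord [] = ε
  evalWord ((b , c) ∷ w) = (if b then c else c ⁻¹) ∙ evalWord w

  Generates : (Carrier → Bool) → Set
  Generates C = ∀ g → ∃ λ (w : List (Bool × Carrier)) →
    All (λ p → C (proj₂ p) ≡ true) w × evalWord w ≡ g

  _⊂_ : (Carrier → Bool) → (Carrier → Bool) → Set
  D ⊂ C = (∀ x → D x ≡ true → C x ≡ true) × ∃ λ x → C x ≡ true × D x ≡ false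

  MinimalGenerating : (Carrier → Bool) → Set
  MinimalGenerating C = Generates C × (∀ D → D ⊂ C → ¬ Generates D)

record Graph : Set₁ where
  field
    V        : Set
    _≟_      : DecidableEquality V
    elems    : List V
    complete : ∀ v → v ∈ elems
    adj      : V → V → Bool

  Adj : V → V → Set
  Adj u v = adj u v ≡ true

Cay : (S : FiniteSemigroup) → (FiniteSemigroup.Carrier S → Bool) → Graph
Cay S C = record
  { V = Carrier ; _≟_ = _≟_ ; elems = elems ; complete = complete
  ; adj = λ s₁ s₂ → not (does (s₁ ≟ s₂)) ∧
            any (λ c → C c ∧ (does ((s₁ ∙ c) ≟ s₂) ∨ does ((s₂ ∙ c) ≟ s₁))) elems }
  where open FiniteSemigroup S

module _ (Γ : Graph) where
  open Graph Γ

  PathThrough : V → List V → V → Set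
  PathThrough a xs b = Linked Adj (a ∷ xs ++ [ b ])

  -- Γ contains a subgraph which is a subdivision of K_{2,2}:
  -- branch vertices a₁ a₂ | b₁ b₂, paths Pᵢⱼ from aᵢ to bⱼ with internal
  -- vertex lists xᵢⱼ, all of these vertices pairwise distinct
  -- (so the paths are simple and internally disjoint).
  HasK22Subdivision : Set
  HasK22Subdivision = ∃ λ (a₁ : V) → ∃ λ (a₂ : V) → ∃ λ (b₁ : V) → ∃ λ (b₂ : V) →
    ∃ λ (x₁₁ : List V) → ∃ λ (x₁₂ : List V) → ∃ λ (x₂₁ : List V) → ∃ λ (x₂₂ : List V) →
      Unique (a₁ ∷ a₂ ∷ b₁ ∷ b₂ ∷ x₁₁ ++ x₁₂ ++ x₂₁ ++ x₂₂) ×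
      PathThrough a₁ x₁₁ b₁ × PathThrough a₁ x₁₂ b₂ ×
      PathThrough a₂ x₂₁ b₁ × PathThrough a₂ x₂₂ b₂

  Connected : Set
  Connected = ∀ u v → Star Adj u v

  iter : {A : Set} → (A → A) → ℕ → A → A
  iter f zero x = x
  iter f (suc k) x = f (iter f k x)

  -- Rotation system: ρ v is a cyclic permutation of the neighbours of v
  -- (ρ v u = successor of u in the cyclic order around v).
  record RotationSystem : Set where
    field
      ρ        : V → V → V
      ρ-adj    : ∀ v u → Adj v u → Adj v (ρ v u)
      ρ-cyclic : ∀ v u w → Adj v u → Adj v w → ∃ λ k → iter (ρ v) k u ≡ w

  vertices : List V
  vertices = deduplicate _≟_ elems

  Dart : Set
  Dart = V × V

  _≟D_ : DecidableEquality Dart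
  _≟D_ = ≡-dec _≟_ _≟_

  -- darts (v , u) = edge vu directed from v to u; #darts = 2|E|
  darts : List Dart
  darts = filter (λ d → Data.Bool._≟_ (adj (proj₁ d) (proj₂ d)) true)
                 (cartesianProduct vertices vertices)

  -- number of faces of the embedding given by a rotation system:
  -- number of orbits of the face-tracing permutation φ(v , u) = (u , ρ u v)
  -- on darts (counted as orbit representatives first met in `darts`).
  numFaces : RotationSystem → ℕ
  numFaces R = go [] darts
    where
    open RotationSystem R
    φ : Dart → Dart
    φ (v , u) = (u , ρ u v)
    seen? : List Dart → Dart → Bool
    seen? s d = any (λ k → any (λ e → does (iter φ k d ≟D e)) s) (upTo (length darts))
    go : List Dart → List Dart → ℕ
    go s [] = 0
    go s (d ∷ ds) = (if seen? s d then 0 else 1) + go (d ∷ s) ds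

  -- Γ has a 2-cell embedding on the torus (orientable genus 1):
  -- Γ connected and some rotation system has Euler characteristic
  -- |V| - |E| + |F| = 0, i.e. 2(|V| + |F|) = #darts.
  EmbeddableOnTorus : Set
  EmbeddableOnTorus = Connected × Σ RotationSystem (λ R →
    2 * (length vertices + numFaces R) ≡ length darts)

{-# OPTIONS --safe #-}
module Submission where

-- Minimality forces ε ∉ C, so (g , i) and (h , j) are adjacent in Γ = Cay(G × R_r, C × R_r)
-- exactly when g and h are adjacent in Cay(G, C); by left translation, a vertex of degree d in
-- Cay(G, C) gives every vertex of Γ degree at least r d. The first edges of two branch paths
-- of the K_{2,2}-subdivision give d ≥ 2. Faces of an embedding are the orbits of the
-- face-tracing permutation on darts, and have length at least 3 as Γ is loopless of minimum
-- degree at least 2. If all faces have length at least k and all degrees are at least δ, the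
-- torus relation V − E + F = 0 forces k δ ≤ 2 (k + δ). If some face is a triangle, its
-- projection is a triangle of Cay(G, C); translated to a branch vertex of the subdivision, it
-- cannot contain all branch paths starting there, and an edge leaving it gives d ≥ 3, so
-- k = 3 and δ = 3r ≥ 9 break the bound. Otherwise k = 4 and δ = 2r ≥ 6 break it.

open import Defs

open import Algebra.Bundles using (Group)
open import Algebra.Structures using (IsGroup)
import Algebra.Properties.Group as GroupProperties
open import Data.Bool using (Bool; true; false; T; if_then_else_; _∧_; _∨_; not)
import Data.Bool as Bool
open import Data.Bool.ListAction using (any)
open import Data.Bool.Properties using (T-≡; ∧-conicalˡ; ∧-zeroʳ)
open import Data.Empty using (⊥-elim)
open import Data.Fin using (toℕ; fromℕ<)
import Data.Fin.Properties as Fin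
open import Data.List using (List; []; _∷_; _++_; [_]; length; map; concatMap; applyUpTo; upTo; lookup; cartesianProduct; filter; allFin)
open import Data.List.Properties using (length-map; length-++; length-applyUpTo; length-tabulate; filter-++)
open import Data.List.Membership.Propositional using (_∈_; lose; find)
open import Data.List.Membership.Propositional.Properties
import Data.List.Membership.DecPropositional as DecMembership
open import Data.List.Relation.Binary.Disjoint.Propositional using (Disjoint)
open import Data.List.Relation.Unary.All using (All; []; _∷_)
import Data.List.Relation.Unary.All as All
import Data.List.Relation.Unary.All.Properties as All
open import Data.List.Relation.Unary.AllPairs using (AllPairs; []; _∷_)
import Data.List.Relation.Unary.AllPairs.Properties as AllPairs
open import Data.List.Relation.Unary.Any using (Any; here; there; index)
import Data.List.Relation.Unary.Any as Any
open import Data.List.Relation.Unary.Any.Properties using (lookup-index; any⁺; any⁻)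
open import Data.List.Relation.Unary.Linked using (Linked; [-]; _∷_)
open import Data.List.Relation.Unary.Unique.Propositional using (Unique)
open import Data.List.Relation.Unary.Unique.Propositional.Properties using (map⁺; concat⁺; applyUpTo⁺₁; take⁺; cartesianProduct⁺; allFin⁺)
open import Data.Nat using (ℕ; zero; suc; _+_; _*_; _∸_; _≤_; _<_; _≤?_; z≤n; s≤s)
open import Data.Nat.DivMod using (_%_; _/_; m≡m%n+[m/n]*n; m%n<n)
open import Data.Nat.Properties hiding (_≟_)
open import Data.Nat.Tactic.RingSolver using (solve-∀)
open import Data.Product using (∃; _×_; _,_; proj₁; proj₂)
open import Data.Sum using (_⊎_; inj₁; inj₂)
import Data.Sum as Sum
open import Data.Unit using (tt)
open import Function using (_∘_; id; case_of_)
open import Function.Bundles using (Equivalence)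
open import Relation.Binary.PropositionalEquality using (_≡_; _≢_; refl; sym; trans; cong; cong₂; subst; subst₂; module ≡-Reasoning)
open import Relation.Nullary using (¬_; Dec; does; yes; no)
open import Relation.Nullary.Decidable using (dec-true; dec-false; from-no)
open import Relation.Unary using (Decidable)
open ≡-Reasoning

∈-remove : ∀ {A : Set} {x : A} {ys : List A} → x ∈ ys →
  ∃ λ ys′ → length ys ≡ suc (length ys′) × (∀ {z} → z ∈ ys → z ≢ x → z ∈ ys′)
∈-remove {ys = y ∷ ys} (here refl) = ys , refl , λ where
  (here refl) z≢y → ⊥-elim (z≢y refl)
  (there z∈ys) _  → z∈ys
∈-remove {ys = y ∷ ys} (there x∈ys) with ∈-remove x∈ys
... | ys′ , eq , keep = y ∷ ys′ , cong suc eq , λ where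
  (here refl) _    → here refl
  (there z∈ys) z≢x → there (keep z∈ys z≢x)

Unique⇒length≤ : ∀ {A : Set} {xs ys : List A} → Unique xs →
  (∀ {z} → z ∈ xs → z ∈ ys) → length xs ≤ length ys
Unique⇒length≤ {xs = []} _ _ = z≤n
Unique⇒length≤ {xs = x ∷ xs} (x∉xs ∷ u) xs⊆ys with ∈-remove (xs⊆ys (here refl))
... | ys′ , eq , keep = subst (suc (length xs) ≤_) (sym eq)
  (s≤s (Unique⇒length≤ u (λ z∈xs → keep (xs⊆ys (there z∈xs)) (λ z≡x → All.lookup x∉xs z∈xs (sym z≡x)))))

length-cartesianProduct : ∀ {A B : Set} (xs : List A) (ys : List B) →
  length (cartesianProduct xs ys) ≡ length xs * length ys
length-cartesianProduct []       ys = refl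
length-cartesianProduct (x ∷ xs) ys = begin
  length (map (x ,_) ys ++ cartesianProduct xs ys)
    ≡⟨ length-++ (map (x ,_) ys) ⟩
  length (map (x ,_) ys) + length (cartesianProduct xs ys)
    ≡⟨ cong₂ _+_ (length-map _ ys) (length-cartesianProduct xs ys) ⟩
  length ys + length xs * length ys
    ∎

length-concatMap-const : ∀ {A B : Set} (f : A → List B) k → (∀ x → length (f x) ≡ k) →
  ∀ xs → length (concatMap f xs) ≡ length xs * k
length-concatMap-const f k len [] = refl
length-concatMap-const f k len (x ∷ xs) = begin
  length (f x ++ concatMap f xs)         ≡⟨ length-++ (f x) ⟩
  length (f x) + length (concatMap f xs) ≡⟨ cong₂ _+_ (len x) (length-concatMap-const f k len xs) ⟩
  k + length xs * k                      ∎

last∈ : ∀ {A : Set} {a b : A} xs → b ∈ a ∷ xs ++ [ b ]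
last∈ xs = there (∈-++⁺ʳ xs (here refl))

Unique-++⇒≢ : ∀ {A : Set} {x y : A} xs {ys} → Unique (xs ++ ys) → x ∈ xs → y ∈ ys → x ≢ y
Unique-++⇒≢ (_ ∷ xs) (x≢ ∷ _)      (here refl) y∈ = All.lookup x≢ (∈-++⁺ʳ xs y∈)
Unique-++⇒≢ (_ ∷ xs) (_ ∷ unique) (there x∈)  y∈ = Unique-++⇒≢ xs unique x∈ y∈

Linked-stays-or-leaves : ∀ {A : Set} {R : A → A → Set} {P : A → Set} → Decidable P →
  ∀ {xs} → Linked R xs → Any P xs → All P xs ⊎ ∃ λ y → ∃ λ z → P y × ¬ P z × (R y z ⊎ R z y)
Linked-stays-or-leaves P? [-] (here py) = inj₁ (py ∷ [])
Linked-stays-or-leaves P? {y ∷ z ∷ _} (yz ∷ walk) (here py) with P? z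
... | no ¬pz = inj₂ (y , z , py , ¬pz , inj₁ yz)
... | yes pz = Sum.map₁ (py ∷_) (Linked-stays-or-leaves P? walk (here pz))
Linked-stays-or-leaves P? {y ∷ z ∷ _} (yz ∷ walk) (there p∈) with Linked-stays-or-leaves P? walk p∈
... | inj₂ leaves = inj₂ leaves
... | inj₁ (pz ∷ stays) with P? y
...   | yes py = inj₁ (py ∷ pz ∷ stays)
...   | no ¬py = inj₂ (z , y , pz , ¬py , inj₂ yz)

module _ (Γ : Graph) where
  open Graph Γ

  NeighbourList : V → List V → Set
  NeighbourList v ns = Unique ns × (∀ {u} → u ∈ ns → Adj v u)

  Degree≥ : V → ℕ → Set
  Degree≥ v m = ∃ λ ns → NeighbourList v ns × m ≤ length ns

  MinDegree : ℕ → Set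
  MinDegree m = ∀ v → Degree≥ v m

  ∈-darts⁺ : ∀ {v u} → Adj v u → (v , u) ∈ darts Γ
  ∈-darts⁺ {v} {u} = ∈-filter⁺ _
    (∈-cartesianProduct⁺ (∈-deduplicate⁺ _≟_ (complete v)) (∈-deduplicate⁺ _≟_ (complete u)))

  ∈-darts⁻ : ∀ {v u} → (v , u) ∈ darts Γ → Adj v u
  ∈-darts⁻ d∈ = proj₂ (∈-filter⁻ _ {xs = cartesianProduct (vertices Γ) (vertices Γ)} d∈)

  MinDegree-weaken : ∀ {m n} → m ≤ n → MinDegree n → MinDegree m
  MinDegree-weaken m≤n deg v = let ns , neighbours , n≤ = deg v in ns , neighbours , ≤-trans m≤n n≤

  vertices-nonempty : V → 0 < length (vertices Γ)
  vertices-nonempty v = ∈-length (∈-deduplicate⁺ _≟_ (complete v))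

  first-step : ∀ {a xs b} → PathThrough Γ a xs b → ∃ λ n → Adj a n × n ∈ xs ++ [ b ]
  first-step {xs = []}    (ab ∷ _) = _ , ab , here refl
  first-step {xs = _ ∷ _} (ay ∷ _) = _ , ay , here refl

  Triangle : Set
  Triangle = ∃ λ v → ∃ λ u → ∃ λ w → Adj v u × Adj u w × Adj w v

  another-neighbour : MinDegree 2 → ∀ v u → ∃ λ w → Adj v w × w ≢ u
  another-neighbour deg v u with deg v
  ... | _ ∷ [] , _ , s≤s ()
  ... | n₁ ∷ n₂ ∷ _ , ((n₁≢n₂ ∷ _) ∷ _ , adj) , _ with n₁ ≟ u
  ...   | yes refl = n₂ , adj (there (here refl)) , n₁≢n₂ ∘ sym
  ...   | no n₁≢u  = n₁ , adj (here refl) , n₁≢u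

  vertices*m≤darts : ∀ {m} → MinDegree m → length (vertices Γ) * m ≤ length (darts Γ)
  vertices*m≤darts {m} deg = darts-from (vertices Γ)
    where
    IsEdge? : (d : Dart Γ) → Dec (adj (proj₁ d) (proj₂ d) ≡ true)
    IsEdge? d = adj (proj₁ d) (proj₂ d) Bool.≟ true

    darts-at : ∀ v → m ≤ length (filter IsEdge? (map (v ,_) (vertices Γ)))
    darts-at v with deg v
    ... | ns , (unique , adjacent) , m≤ = ≤-trans m≤ (subst (_≤ _) (length-map (v ,_) ns)
      (Unique⇒length≤ (map⁺ (cong proj₂) unique) λ vu∈ → case ∈-map⁻ (v ,_) vu∈ of λ where
        (u , u∈ , refl) → ∈-filter⁺ IsEdge?
          (∈-map⁺ (v ,_) (∈-deduplicate⁺ _≟_ (complete u))) (adjacent u∈)))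

    darts-from : ∀ xs → length xs * m ≤ length (filter IsEdge? (cartesianProduct xs (vertices Γ)))
    darts-from []       = z≤n
    darts-from (v ∷ xs) = subst (m + length xs * m ≤_) (sym (begin
      length (filter IsEdge? (row ++ rest))          ≡⟨ cong length (filter-++ IsEdge? row rest) ⟩
      length (filter IsEdge? row ++ filter IsEdge? rest) ≡⟨ length-++ (filter IsEdge? row) ⟩
      _                                              ∎)) (+-mono-≤ (darts-at v) (darts-from xs))
      where
      row  = map (v ,_) (vertices Γ)
      rest = cartesianProduct xs (vertices Γ)

module FaceTracing (Γ : Graph) (R : RotationSystem Γ)
                   (Adj-sym : ∀ {u v} → Graph.Adj Γ u v → Graph.Adj Γ v u) where
  open Graph Γ
  open RotationSystem R

  φ : Dart Γ → Dart Γ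
  φ (v , u) = u , ρ u v

  φ^ : ℕ → Dart Γ → Dart Γ
  φ^ = iter Γ φ

  N : ℕ
  N = length (darts Γ)

  IsDart : Dart Γ → Set
  IsDart d = d ∈ darts Γ

  ∈darts⁺ : ∀ {v u} → Adj v u → IsDart (v , u)
  ∈darts⁺ = ∈-darts⁺ Γ

  ∈darts⁻ : ∀ {v u} → IsDart (v , u) → Adj v u
  ∈darts⁻ = ∈-darts⁻ Γ

  φ^-+ : ∀ m n d → φ^ (m + n) d ≡ φ^ m (φ^ n d)
  φ^-+ zero    n d = refl
  φ^-+ (suc m) n d = cong φ (φ^-+ m n d)

  φ^-suc : ∀ n d → φ^ (suc n) d ≡ φ^ n (φ d)
  φ^-suc zero    d = refl
  φ^-suc (suc n) d = cong φ (φ^-suc n d)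

  φ^-* : ∀ q {p d} → φ^ p d ≡ d → φ^ (q * p) d ≡ d
  φ^-* zero          _  = refl
  φ^-* (suc q) {p} {d} pd = begin
    φ^ (p + q * p) d    ≡⟨ φ^-+ p (q * p) d ⟩
    φ^ p (φ^ (q * p) d) ≡⟨ cong (φ^ p) (φ^-* q pd) ⟩
    φ^ p d              ≡⟨ pd ⟩
    d                   ∎

  φ-dart : ∀ {d} → IsDart d → IsDart (φ d)
  φ-dart {v , u} d∈ = ∈darts⁺ (ρ-adj u v (Adj-sym (∈darts⁻ d∈)))

  φ^-dart : ∀ k {d} → IsDart d → IsDart (φ^ k d)
  φ^-dart zero    d∈ = d∈
  φ^-dart (suc k) d∈ = φ-dart (φ^-dart k d∈)

  ρ-iter-adj : ∀ u k {x} → Adj u x → Adj u (iter Γ (ρ u) k x)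
  ρ-iter-adj u zero    ux = ux
  ρ-iter-adj u (suc k) ux = ρ-adj u _ (ρ-iter-adj u k ux)

  -- Since ρ u is cyclic on the neighbours of u, w is reached from ρ u w; the step before is a preimage.
  ρ-onto : ∀ u {w} → Adj u w → ∃ λ x → Adj u x × ρ u x ≡ w
  ρ-onto u {w} uw with ρ-cyclic u (ρ u w) w (ρ-adj u w uw) uw
  ... | zero  , eq = w , uw , eq
  ... | suc k , eq = iter Γ (ρ u) k (ρ u w) , ρ-iter-adj u k (ρ-adj u w uw) , eq

  φ-onto : ∀ {e} → IsDart e → ∃ λ d → IsDart d × φ d ≡ e
  φ-onto {u , w} e∈ with ρ-onto u (∈darts⁻ e∈)
  ... | x , ux , eq = (x , u) , ∈darts⁺ (Adj-sym ux) , cong (u ,_) eq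

  φ^-onto : ∀ n {e} → IsDart e → ∃ λ d → IsDart d × φ^ n d ≡ e
  φ^-onto zero    {e} e∈ = e , e∈ , refl
  φ^-onto (suc n)     e∈ with φ^-onto n e∈
  ... | d , d∈ , eq with φ-onto d∈
  ...   | c , c∈ , refl = c , c∈ , trans (φ^-suc n c) eq

  -- Pigeonhole on the N + 1 preimages of d under φ⁰, …, φᴺ, all of which are darts.
  φ-periodic : ∀ {d} → IsDart d → ∃ λ p → 0 < p × p ≤ N × φ^ p d ≡ d
  φ-periodic {d} d∈ with Fin.pigeonhole (n<1+n N) (λ i → index (preimage∈ (toℕ i)))
    where
    preimage∈ : ∀ n → proj₁ (φ^-onto n d∈) ∈ darts Γ
    preimage∈ n = proj₁ (proj₂ (φ^-onto n d∈))
  ... | i , j , i<j , same-index =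
    toℕ j ∸ toℕ i , m<n⇒0<n∸m i<j , ≤-trans (m∸n≤m (toℕ j) (toℕ i)) (Fin.toℕ≤pred[n] j) , returns
    where
    cᵢ = φ^-onto (toℕ i) d∈
    cⱼ = φ^-onto (toℕ j) d∈
    same-preimage : proj₁ cᵢ ≡ proj₁ cⱼ
    same-preimage = begin
      proj₁ cᵢ                                    ≡⟨ lookup-index (proj₁ (proj₂ cᵢ)) ⟩
      lookup (darts Γ) (index (proj₁ (proj₂ cᵢ))) ≡⟨ cong (lookup (darts Γ)) same-index ⟩
      lookup (darts Γ) (index (proj₁ (proj₂ cⱼ))) ≡⟨ lookup-index (proj₁ (proj₂ cⱼ)) ⟨
      proj₁ cⱼ                                    ∎
    returns : φ^ (toℕ j ∸ toℕ i) d ≡ d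
    returns = begin
      φ^ (toℕ j ∸ toℕ i) d                       ≡⟨ cong (φ^ (toℕ j ∸ toℕ i)) (proj₂ (proj₂ cᵢ)) ⟨
      φ^ (toℕ j ∸ toℕ i) (φ^ (toℕ i) (proj₁ cᵢ)) ≡⟨ φ^-+ (toℕ j ∸ toℕ i) (toℕ i) _ ⟨
      φ^ (toℕ j ∸ toℕ i + toℕ i) (proj₁ cᵢ)      ≡⟨ cong₂ φ^ (m∸n+n≡m (<⇒≤ i<j)) same-preimage ⟩
      φ^ (toℕ j) (proj₁ cⱼ)                      ≡⟨ proj₂ (proj₂ cⱼ) ⟩
      d                                          ∎

  Reaches : Dart Γ → Dart Γ → Set
  Reaches e d = ∃ λ k → k < N × φ^ k e ≡ d

  reaches-within-N : ∀ {e d} x → IsDart e → φ^ x e ≡ d → Reaches e d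
  reaches-within-N {e} {d} x e∈ eq with φ-periodic e∈
  ... | suc p , _ , p≤N , periodic = x % suc p , <-≤-trans (m%n<n x (suc p)) p≤N , (begin
    φ^ (x % suc p) e                         ≡⟨ cong (φ^ (x % suc p)) (φ^-* (x / suc p) periodic) ⟨
    φ^ (x % suc p) (φ^ (x / suc p * suc p) e) ≡⟨ φ^-+ (x % suc p) _ e ⟨
    φ^ (x % suc p + x / suc p * suc p) e      ≡⟨ cong (λ n → φ^ n e) (m≡m%n+[m/n]*n x (suc p)) ⟨
    φ^ x e                                   ≡⟨ eq ⟩
    d                                        ∎)

  -- φ is periodic on d, so running d′ on from the meeting point wraps around to d.
  meet⇒reaches : ∀ {d d′} a b → IsDart d → IsDart d′ → φ^ a d ≡ φ^ b d′ → Reaches d′ d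
  meet⇒reaches {d} {d′} a b d∈ d′∈ meet with φ-periodic d∈
  ... | suc p , _ , _ , periodic = reaches-within-N (a * p + b) d′∈ (begin
    φ^ (a * p + b) d′      ≡⟨ φ^-+ (a * p) b d′ ⟩
    φ^ (a * p) (φ^ b d′)   ≡⟨ cong (φ^ (a * p)) meet ⟨
    φ^ (a * p) (φ^ a d)    ≡⟨ φ^-+ (a * p) a d ⟨
    φ^ (a * p + a) d       ≡⟨ cong (λ n → φ^ n d) (trans (+-comm (a * p) a) (sym (*-suc a p))) ⟩
    φ^ (a * suc p) d       ≡⟨ φ^-* a periodic ⟩
    d                      ∎)

  seen? : List (Dart Γ) → Dart Γ → Bool
  seen? s d = any (λ k → any (λ e → does (_≟D_ Γ (φ^ k d) e)) s) (upTo N)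

  representatives : List (Dart Γ) → List (Dart Γ) → List (Dart Γ)
  representatives s []       = []
  representatives s (d ∷ ds) =
    if seen? s d then representatives (d ∷ s) ds else d ∷ representatives (d ∷ s) ds

  length-representatives-unique : (count : List (Dart Γ) → List (Dart Γ) → ℕ) →
    (∀ s → count s [] ≡ 0) →
    (∀ s d ds → count s (d ∷ ds) ≡ (if seen? s d then 0 else 1) + count (d ∷ s) ds) →
    ∀ s L → count s L ≡ length (representatives s L)
  length-representatives-unique count count-[] count-∷ s []       = count-[] s
  length-representatives-unique count count-[] count-∷ s (d ∷ ds) with seen? s d | count-∷ s d ds
  ... | true  | step = trans step rest
    where rest = length-representatives-unique count count-[] count-∷ (d ∷ s) ds
  ... | false | step = trans step (cong suc rest)
    where rest = length-representatives-unique count count-[] count-∷ (d ∷ s) ds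

  noDarts : List (Dart Γ)
  noDarts = []

  -- The counting loop local to numFaces cannot be named: 'with' abstracts its arguments (the
  -- initial [] through noDarts, since 'with' does not abstract constructors) and unification
  -- recovers the loop, which satisfies the equations of length-representatives-unique by refl.
  mutual
    numFaces≡length-representatives : numFaces Γ R ≡ length (representatives [] (darts Γ))
    numFaces≡length-representatives with darts Γ | noDarts
    ... | L | s = numFacesLoop≡length-representatives s L

    numFacesLoop≡length-representatives : ∀ s L → _ ≡ length (representatives s L)
    numFacesLoop≡length-representatives = length-representatives-unique _ (λ _ → refl) (λ _ _ _ → refl)

  seen?-reaches : ∀ {s d e} → e ∈ s → Reaches d e → T (seen? s d)
  seen?-reaches {d = d} {e} e∈s (k , k<N , eq) = any⁺ _ (lose (∈-upTo⁺ k<N) (any⁺ _ (lose e∈s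
    (Equivalence.from T-≡ (dec-true (_≟D_ Γ (φ^ k d) e) eq)))))

  ∈-representatives⁻ : ∀ s L {d} → d ∈ representatives s L → d ∈ L × (∀ {e} → e ∈ s → ¬ Reaches d e)
  ∈-representatives⁻ s (d ∷ ds) d′∈ with seen? s d in seen
  ... | true = let d′∈ds , fresh = ∈-representatives⁻ (d ∷ s) ds d′∈ in there d′∈ds , fresh ∘ there
  ∈-representatives⁻ s (d ∷ ds) (here refl) | false =
    here refl , λ e∈s reaches → subst T seen (seen?-reaches e∈s reaches)
  ∈-representatives⁻ s (d ∷ ds) (there d′∈) | false =
    let d′∈ds , fresh = ∈-representatives⁻ (d ∷ s) ds d′∈ in there d′∈ds , fresh ∘ there

  orbitPrefix : ℕ → Dart Γ → List (Dart Γ)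
  orbitPrefix k d = applyUpTo (λ i → φ^ i d) k

  orbitPrefix-disjoint : ∀ k {d d′} → IsDart d → IsDart d′ → ¬ Reaches d′ d →
    Disjoint (orbitPrefix k d) (orbitPrefix k d′)
  orbitPrefix-disjoint k d∈ d′∈ ¬reaches (x∈ , x∈′)
    with ∈-applyUpTo⁻ _ x∈ | ∈-applyUpTo⁻ _ x∈′
  ... | a , _ , refl | b , _ , eq = ¬reaches (meet⇒reaches a b d∈ d′∈ eq)

  representatives-disjoint : ∀ k s L → (∀ {d} → d ∈ L → IsDart d) →
    AllPairs (λ d d′ → Disjoint (orbitPrefix k d) (orbitPrefix k d′)) (representatives s L)
  representatives-disjoint k s []       _    = []
  representatives-disjoint k s (d ∷ ds) L⊆Ds with seen? s d
  ... | true  = representatives-disjoint k (d ∷ s) ds (L⊆Ds ∘ there)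
  ... | false = All.tabulate later-disjoint ∷ representatives-disjoint k (d ∷ s) ds (L⊆Ds ∘ there)
    where
    later-disjoint : ∀ {d′} → d′ ∈ representatives (d ∷ s) ds →
      Disjoint (orbitPrefix k d) (orbitPrefix k d′)
    later-disjoint d′∈ = let d′∈ds , fresh = ∈-representatives⁻ (d ∷ s) ds d′∈ in
      orbitPrefix-disjoint k (L⊆Ds (here refl)) (L⊆Ds (there d′∈ds)) (fresh (here refl))

  numFaces*k≤N : ∀ k → (∀ {d} → IsDart d → Unique (orbitPrefix k d)) → numFaces Γ R * k ≤ N
  numFaces*k≤N k prefix-unique = subst (_≤ N) (sym faces*k≡) (Unique⇒length≤ unique ⊆darts)
    where
    reps = representatives [] (darts Γ)
    prefixes = concatMap (orbitPrefix k) reps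

    reps⊆darts : ∀ {d} → d ∈ reps → IsDart d
    reps⊆darts = proj₁ ∘ ∈-representatives⁻ [] (darts Γ)

    faces*k≡ : numFaces Γ R * k ≡ length prefixes
    faces*k≡ = begin
      numFaces Γ R * k  ≡⟨ cong (_* k) numFaces≡length-representatives ⟩
      length reps * k   ≡⟨ length-concatMap-const (orbitPrefix k) k (λ d → length-applyUpTo _ k) reps ⟨
      length prefixes   ∎

    unique : Unique prefixes
    unique = concat⁺ (All.map⁺ (All.tabulate (prefix-unique ∘ reps⊆darts)))
                     (AllPairs.map⁺ (representatives-disjoint k [] (darts Γ) id))

    ⊆darts : ∀ {x} → x ∈ prefixes → IsDart x
    ⊆darts x∈ with find (∈-concatMap⁻ (orbitPrefix k) {xs = reps} x∈)
    ... | d , d∈ , x∈prefix with ∈-applyUpTo⁻ _ x∈prefix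
    ...   | i , _ , refl = φ^-dart i (reps⊆darts d∈)

  orbitPrefix-unique : ∀ k → (∀ {e} → IsDart e → ∀ m → 0 < m → m < k → φ^ m e ≢ e) →
    ∀ {d} → IsDart d → Unique (orbitPrefix k d)
  orbitPrefix-unique k no-return {d} d∈ = applyUpTo⁺₁ _ k λ {i} {j} i<j j<k φⁱ≡φʲ →
    no-return (φ^-dart i d∈) (j ∸ i) (m<n⇒0<n∸m i<j) (≤-<-trans (m∸n≤m j i) j<k) (begin
      φ^ (j ∸ i) (φ^ i d) ≡⟨ φ^-+ (j ∸ i) i d ⟨
      φ^ (j ∸ i + i) d    ≡⟨ cong (λ n → φ^ n d) (m∸n+n≡m (<⇒≤ i<j)) ⟩
      φ^ j d              ≡⟨ φⁱ≡φʲ ⟨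
      φ^ i d              ∎)

  module ShortFaces (loopless : ∀ {v} → ¬ Adj v v) (minDegree : MinDegree Γ 2) where

    φ-no-fixpoint : ∀ {d} → IsDart d → φ d ≢ d
    φ-no-fixpoint {v , u} d∈ eq = loopless (subst (λ x → Adj x u) (sym (cong proj₁ eq)) (∈darts⁻ d∈))

    ρ-fixpoint : ∀ u {v} k → ρ u v ≡ v → iter Γ (ρ u) k v ≡ v
    ρ-fixpoint u zero    _   = refl
    ρ-fixpoint u (suc k) fix = trans (cong (ρ u) (ρ-fixpoint u k fix)) fix

    -- φ² (v , u) = (v , u) means ρ u fixes v, so v would be the only neighbour of u.
    φ²-no-fixpoint : ∀ {d} → IsDart d → φ (φ d) ≢ d
    φ²-no-fixpoint {v , u} d∈ eq with another-neighbour Γ minDegree u v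
    ... | w , uw , w≢v with ρ-cyclic u v w (Adj-sym (∈darts⁻ d∈)) uw
    ...   | k , ρᵏv≡w = w≢v (trans (sym ρᵏv≡w) (ρ-fixpoint u k (cong proj₁ eq)))

    no-return-before-3 : ∀ {d} → IsDart d → ∀ m → 0 < m → m < 3 → φ^ m d ≢ d
    no-return-before-3 d∈ 1 _ _ = φ-no-fixpoint d∈
    no-return-before-3 d∈ 2 _ _ = φ²-no-fixpoint d∈
    no-return-before-3 d∈ (suc (suc (suc _))) _ (s≤s (s≤s (s≤s ())))

    numFaces*3≤N : numFaces Γ R * 3 ≤ N
    numFaces*3≤N = numFaces*k≤N 3 (orbitPrefix-unique 3 no-return-before-3)

    φ³-fixpoint⇒triangle : ∀ {d} → IsDart d → φ^ 3 d ≡ d → Triangle Γ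
    φ³-fixpoint⇒triangle {v , u} d∈ eq = v , u , ρ u v , ∈darts⁻ d∈ , ∈darts⁻ (φ-dart d∈) ,
      subst (Adj (ρ u v)) (cong proj₁ eq) (∈darts⁻ (φ-dart (φ-dart d∈)))

    triangle-or-numFaces*4≤N : Triangle Γ ⊎ numFaces Γ R * 4 ≤ N
    triangle-or-numFaces*4≤N with Any.any? (λ d → _≟D_ Γ (φ^ 3 d) d) (darts Γ)
    ... | yes triangular = let d , d∈ , eq = find triangular in inj₁ (φ³-fixpoint⇒triangle d∈ eq)
    ... | no ¬triangular = inj₂ (numFaces*k≤N 4 (orbitPrefix-unique 4 no-return-before-4))
      where
      no-return-before-4 : ∀ {d} → IsDart d → ∀ m → 0 < m → m < 4 → φ^ m d ≢ d
      no-return-before-4 d∈ 3 _ _ eq = ¬triangular (lose d∈ eq)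
      no-return-before-4 d∈ 1 _ _ = φ-no-fixpoint d∈
      no-return-before-4 d∈ 2 _ _ = φ²-no-fixpoint d∈
      no-return-before-4 d∈ (suc (suc (suc (suc _)))) _ (s≤s (s≤s (s≤s (s≤s ()))))

-- Multiply Euler's relation 2 (V + F) = N by k δ and bound F k and V δ by N.
euler-torus-bound : ∀ {V F N} k δ → 2 * (V + F) ≡ N → F * k ≤ N → V * δ ≤ N → 0 < V →
  k * δ ≤ 2 * (k + δ)
euler-torus-bound {suc V} {F} k δ refl Fk≤N Vδ≤N _ = *-cancelʳ-≤ (k * δ) (2 * (k + δ)) N
  (subst₂ _≤_ (sym (expand k δ (suc V) F)) (sym (collect k δ N))
    (+-mono-≤ (*-monoʳ-≤ (2 * k) Vδ≤N) (*-monoʳ-≤ (2 * δ) Fk≤N)))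
  where
  N = 2 * (suc V + F)
  expand : ∀ k δ V F → k * δ * (2 * (V + F)) ≡ 2 * k * (V * δ) + 2 * δ * (F * k)
  expand = solve-∀
  collect : ∀ k δ N → 2 * (k + δ) * N ≡ 2 * k * N + 2 * δ * N
  collect = solve-∀

bound-fails-for-3-and-3r : ∀ {r} → 3 ≤ r → ¬ 3 * (3 * r) ≤ 2 * (3 + 3 * r)
bound-fails-for-3-and-3r {r} 3≤r bound = from-no (9 ≤? 6)
  (≤-trans (*-monoʳ-≤ 3 3≤r) (+-cancelʳ-≤ (6 * r) (3 * r) 6 (subst₂ _≤_ (lhs r) (rhs r) bound)))
  where
  lhs : ∀ r → 3 * (3 * r) ≡ 3 * r + 6 * r
  lhs = solve-∀
  rhs : ∀ r → 2 * (3 + 3 * r) ≡ 6 + 6 * r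
  rhs = solve-∀

bound-fails-for-4-and-2r : ∀ {r} → 3 ≤ r → ¬ 4 * (2 * r) ≤ 2 * (4 + 2 * r)
bound-fails-for-4-and-2r {r} 3≤r bound = from-no (12 ≤? 8)
  (≤-trans (*-monoʳ-≤ 4 3≤r) (+-cancelʳ-≤ (4 * r) (4 * r) 8 (subst₂ _≤_ (lhs r) (rhs r) bound)))
  where
  lhs : ∀ r → 4 * (2 * r) ≡ 4 * r + 4 * r
  lhs = solve-∀
  rhs : ∀ r → 2 * (4 + 2 * r) ≡ 8 + 4 * r
  rhs = solve-∀

module _ (S : FiniteSemigroup) (C : FiniteSemigroup.Carrier S → Bool) where
  open FiniteSemigroup S

  CayEdge : Carrier → Carrier → Set
  CayEdge s t = s ≢ t × ∃ λ c → C c ≡ true × (s ∙ c ≡ t ⊎ t ∙ c ≡ s)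

  Cay-Adj⁻ : ∀ {s t} → Graph.Adj (Cay S C) s t → CayEdge s t
  Cay-Adj⁻ {s} {t} st with s ≟ t
  Cay-Adj⁻ () | yes _
  ... | no s≢t with find (any⁻ _ elems (Equivalence.from T-≡ st))
  ...   | c , _ , edge with C c in Cc | (s ∙ c) ≟ t | (t ∙ c) ≟ s
  ...     | true | yes sc≡t | _        = s≢t , c , Cc , inj₁ sc≡t
  ...     | true | no _     | yes tc≡s = s≢t , c , Cc , inj₂ tc≡s

  Cay-Adj⁺ : ∀ {s t} → CayEdge s t → Graph.Adj (Cay S C) s t
  Cay-Adj⁺ {s} {t} (s≢t , c , Cc , sc∨tc) with s ≟ t
  ... | yes s≡t = ⊥-elim (s≢t s≡t)
  ... | no _    = Equivalence.to T-≡ (any⁺ _ (lose (complete c) (edge sc∨tc)))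
    where
    edge : s ∙ c ≡ t ⊎ t ∙ c ≡ s → T (C c ∧ (does ((s ∙ c) ≟ t) ∨ does ((t ∙ c) ≟ s)))
    edge sc∨tc rewrite Cc with (s ∙ c) ≟ t | (t ∙ c) ≟ s | sc∨tc
    ... | yes _ | _     | _           = tt
    ... | no _  | yes _ | _           = tt
    ... | no ¬p | no _  | inj₁ sc≡t   = ¬p sc≡t
    ... | no _  | no ¬q | inj₂ tc≡s   = ¬q tc≡s

module CayleyGroup (G : FiniteGroup) (C : FiniteGroup.Carrier G → Bool) where
  open FiniteGroup G
  open IsGroup isGroup using (assoc; identityˡ; _//_)

  group : Group _ _
  group = record { isGroup = isGroup }

  open GroupProperties group using (∙-cancelˡ; identityʳ-unique; ε⁻¹≈ε; //-rightDividesˡ)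
  open DecMembership _≟_ using (_∈?_)

  _~_ : Carrier → Carrier → Set
  _~_ = CayEdge (asSemigroup G) C

  ~-sym : ∀ {g h} → g ~ h → h ~ g
  ~-sym (g≢h , c , Cc , sc∨tc) = g≢h ∘ sym , c , Cc , Sum.swap sc∨tc

  ~-translate : ∀ x {g h} → g ~ h → (x ∙ g) ~ (x ∙ h)
  ~-translate x {g} {h} (g≢h , c , Cc , gc∨hc) =
    g≢h ∘ ∙-cancelˡ x g h , c , Cc , Sum.map (translate g h) (translate h g) gc∨hc
    where
    translate : ∀ a b → a ∙ c ≡ b → (x ∙ a) ∙ c ≡ x ∙ b
    translate a b ac≡b = trans (assoc x a c) (cong (x ∙_) ac≡b)

  C∖ε : Carrier → Bool
  C∖ε x = C x ∧ not (does (x ≟ ε))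

  dropε : List (Bool × Carrier) → List (Bool × Carrier)
  dropε []            = []
  dropε ((b , c) ∷ w) with c ≟ ε
  ... | yes _ = dropε w
  ... | no _  = (b , c) ∷ dropε w

  ε-letter : ∀ b y → (if b then ε else ε ⁻¹) ∙ y ≡ y
  ε-letter true  y = identityˡ y
  ε-letter false y = trans (cong (_∙ y) ε⁻¹≈ε) (identityˡ y)

  evalWord-dropε : ∀ w → evalWord G (dropε w) ≡ evalWord G w
  evalWord-dropε []            = refl
  evalWord-dropε ((b , c) ∷ w) with c ≟ ε
  ... | yes refl = trans (evalWord-dropε w) (sym (ε-letter b (evalWord G w)))
  ... | no _     = cong (_ ∙_) (evalWord-dropε w)

  ∈C∖ε : ∀ {c} → C c ≡ true → c ≢ ε → C∖ε c ≡ true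
  ∈C∖ε {c} Cc c≢ε rewrite Cc | dec-false (c ≟ ε) c≢ε = refl

  dropε-letters : ∀ w → All (λ l → C (proj₂ l) ≡ true) w → All (λ l → C∖ε (proj₂ l) ≡ true) (dropε w)
  dropε-letters []            []          = []
  dropε-letters ((b , c) ∷ w) (Cc ∷ Cw) with c ≟ ε
  ... | yes _ = dropε-letters w Cw
  ... | no c≢ε = ∈C∖ε Cc c≢ε ∷ dropε-letters w Cw

  identity∉minimal : MinimalGenerating G C → C ε ≡ false
  identity∉minimal (generates , minimal) with C ε in Cε
  ... | false = refl
  ... | true  = ⊥-elim (minimal C∖ε (C∖ε⊆C , ε , Cε , ε∉C∖ε) generates-without-ε)
    where
    C∖ε⊆C : ∀ x → C∖ε x ≡ true → C x ≡ true
    C∖ε⊆C x = ∧-conicalˡ (C x) _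
    ε∉C∖ε : C∖ε ε ≡ false
    ε∉C∖ε rewrite dec-true (ε ≟ ε) refl = ∧-zeroʳ (C ε)
    generates-without-ε : Generates G C∖ε
    generates-without-ε g with generates g
    ... | w , letters , eval = dropε w , dropε-letters w letters , trans (evalWord-dropε w) eval

  Γ₀ : Graph
  Γ₀ = Cay (asSemigroup G) C

  Adj⇒~ : ∀ {g h} → Graph.Adj Γ₀ g h → g ~ h
  Adj⇒~ = Cay-Adj⁻ (asSemigroup G) C

  ~⇒Adj₀ : ∀ {g h} → g ~ h → Graph.Adj Γ₀ g h
  ~⇒Adj₀ = Cay-Adj⁺ (asSemigroup G) C

  three-neighbours : ∀ {y a b c} → y ~ a → y ~ b → y ~ c → a ≢ b → a ≢ c → b ≢ c → Degree≥ Γ₀ y 3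
  three-neighbours ya yb yc a≢b a≢c b≢c = _ , (((a≢b ∷ a≢c ∷ []) ∷ (b≢c ∷ []) ∷ [] ∷ []) , λ where
    (here refl)                 → ~⇒Adj₀ ya
    (there (here refl))         → ~⇒Adj₀ yb
    (there (there (here refl))) → ~⇒Adj₀ yc) , ≤-refl

  module TriangleThrough {s₁ s₂ s₃} (s₁s₂ : s₁ ~ s₂) (s₁s₃ : s₁ ~ s₃) (s₂s₃ : s₂ ~ s₃) where
    Δ : List Carrier
    Δ = s₁ ∷ s₂ ∷ s₃ ∷ []

    s₁∈Δ : s₁ ∈ Δ
    s₁∈Δ = here refl

    s₂∈Δ : s₂ ∈ Δ
    s₂∈Δ = there (here refl)

    s₃∈Δ : s₃ ∈ Δ
    s₃∈Δ = there (there (here refl))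

    ∈Δ⇒≢ : ∀ {x z} → x ∈ Δ → ¬ z ∈ Δ → x ≢ z
    ∈Δ⇒≢ x∈Δ z∉Δ refl = z∉Δ x∈Δ

    leaving⇒Degree≥3 : ∀ {y z} → y ∈ Δ → ¬ z ∈ Δ → y ~ z → Degree≥ Γ₀ y 3
    leaving⇒Degree≥3 {z = z} (here refl) z∉Δ yz =
      three-neighbours s₁s₂ s₁s₃ yz (proj₁ s₂s₃) (∈Δ⇒≢ s₂∈Δ z∉Δ) (∈Δ⇒≢ s₃∈Δ z∉Δ)
    leaving⇒Degree≥3 {z = z} (there (here refl)) z∉Δ yz =
      three-neighbours (~-sym s₁s₂) s₂s₃ yz (proj₁ s₁s₃) (∈Δ⇒≢ s₁∈Δ z∉Δ) (∈Δ⇒≢ s₃∈Δ z∉Δ)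
    leaving⇒Degree≥3 {z = z} (there (there (here refl))) z∉Δ yz =
      three-neighbours (~-sym s₁s₃) (~-sym s₂s₃) yz (proj₁ s₁s₂) (∈Δ⇒≢ s₁∈Δ z∉Δ) (∈Δ⇒≢ s₂∈Δ z∉Δ)

    walk-stays : ∀ {xs} → Linked (Graph.Adj Γ₀) xs → Any (_∈ Δ) xs →
      (∃ λ g → Degree≥ Γ₀ g 3) ⊎ All (_∈ Δ) xs
    walk-stays walk meets with Linked-stays-or-leaves (_∈? Δ) walk meets
    ... | inj₁ stays = inj₂ stays
    ... | inj₂ (y , z , y∈Δ , z∉Δ , yz⊎zy) =
      inj₁ (y , leaving⇒Degree≥3 y∈Δ z∉Δ (Sum.[ Adj⇒~ , ~-sym ∘ Adj⇒~ ] yz⊎zy))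

    -- The walks a₁b₁, a₁b₂, a₂b₁ of the subdivision start at a₁ = s₁; if none leaves Δ, then
    -- a₂, b₁, b₂ are three distinct vertices of Δ other than s₁.
    K22⇒Degree≥3 : ∀ {a₂ b₁ b₂ x₁₁ x₁₂ x₂₁ x₂₂} →
      Unique (s₁ ∷ a₂ ∷ b₁ ∷ b₂ ∷ x₁₁ ++ x₁₂ ++ x₂₁ ++ x₂₂) →
      PathThrough Γ₀ s₁ x₁₁ b₁ → PathThrough Γ₀ s₁ x₁₂ b₂ → PathThrough Γ₀ a₂ x₂₁ b₁ →
      ∃ λ g → Degree≥ Γ₀ g 3
    K22⇒Degree≥3 {a₂} {b₁} {b₂} {x₁₁} {x₁₂} {x₂₁} (s₁≢ ∷ distinct) p₁₁ p₁₂ p₂₁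
      with walk-stays p₁₁ (here s₁∈Δ)
    ... | inj₁ found = found
    ... | inj₂ stays₁₁ with walk-stays p₁₂ (here s₁∈Δ)
    ...   | inj₁ found = found
    ...   | inj₂ stays₁₂ with walk-stays p₂₁ (lose (last∈ x₂₁) (All.lookup stays₁₁ (last∈ x₁₁)))
    ...     | inj₁ found = found
    ...     | inj₂ stays₂₁ = ⊥-elim (<-irrefl refl (Unique⇒length≤ (take⁺ 3 distinct) ⊆s₂s₃))
      where
      other : ∀ {y} → y ∈ Δ → s₁ ≢ y → y ∈ s₂ ∷ s₃ ∷ []
      other (here refl) s₁≢y = ⊥-elim (s₁≢y refl)
      other (there y∈)  _    = y∈

      ⊆s₂s₃ : ∀ {y} → y ∈ a₂ ∷ b₁ ∷ b₂ ∷ [] → y ∈ s₂ ∷ s₃ ∷ []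
      ⊆s₂s₃ (here refl) =
        other (All.lookup stays₂₁ (here refl)) (All.lookup s₁≢ (here refl))
      ⊆s₂s₃ (there (here refl)) =
        other (All.lookup stays₁₁ (last∈ x₁₁)) (All.lookup s₁≢ (there (here refl)))
      ⊆s₂s₃ (there (there (here refl))) =
        other (All.lookup stays₁₂ (last∈ x₁₂)) (All.lookup s₁≢ (there (there (here refl))))

  ~-translate-to : ∀ a {g h} → g ~ h → a ~ ((a // g) ∙ h)
  ~-translate-to a {g} {h} gh =
    subst (_~ ((a // g) ∙ h)) (//-rightDividesˡ g a) (~-translate (a // g) gh)

  K22×triangle⇒Degree≥3 : HasK22Subdivision Γ₀ → Triangle Γ₀ → ∃ λ g → Degree≥ Γ₀ g 3
  K22×triangle⇒Degree≥3 (a₁ , _ , _ , _ , _ , _ , _ , _ , distinct , p₁₁ , p₁₂ , p₂₁ , _)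
                         (t₁ , t₂ , t₃ , t₁t₂ , t₂t₃ , t₃t₁) =
    TriangleThrough.K22⇒Degree≥3
      (~-translate-to a₁ (Adj⇒~ t₁t₂)) (~-translate-to a₁ (~-sym (Adj⇒~ t₃t₁)))
      (~-translate (a₁ // t₁) (Adj⇒~ t₂t₃)) distinct p₁₁ p₁₂ p₂₁

  K22⇒Degree≥2 : HasK22Subdivision Γ₀ → ∃ λ g → Degree≥ Γ₀ g 2
  K22⇒Degree≥2 (a₁ , _ , b₁ , b₂ , x₁₁ , x₁₂ , _ , _ , _ ∷ _ ∷ b₁≢ ∷ b₂≢ ∷ distinct , p₁₁ , p₁₂ , _)
    with first-step Γ₀ p₁₁ | first-step Γ₀ p₁₂
  ... | n₁ , a₁n₁ , n₁∈ | n₂ , a₁n₂ , n₂∈ =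
    a₁ , _ , (((different (∈-++⁻ x₁₁ n₁∈) (∈-++⁻ x₁₂ n₂∈) ∷ []) ∷ [] ∷ []) , λ where
      (here refl)         → a₁n₁
      (there (here refl)) → a₁n₂) , ≤-refl
    where
    different : ∀ {n₁ n₂} → n₁ ∈ x₁₁ ⊎ n₁ ∈ [ b₁ ] → n₂ ∈ x₁₂ ⊎ n₂ ∈ [ b₂ ] → n₁ ≢ n₂
    different (inj₁ n₁∈) (inj₁ n₂∈)        = Unique-++⇒≢ x₁₁ distinct n₁∈ (∈-++⁺ˡ n₂∈)
    different (inj₁ n₁∈) (inj₂ (here refl)) = All.lookup b₂≢ (∈-++⁺ˡ n₁∈) ∘ sym
    different (inj₂ (here refl)) (inj₁ n₂∈) = All.lookup b₁≢ (there (∈-++⁺ʳ x₁₁ (∈-++⁺ˡ n₂∈)))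
    different (inj₂ (here refl)) (inj₂ (here refl)) = All.lookup b₁≢ (here refl)

module ProductGraph (G : FiniteGroup) (C : FiniteGroup.Carrier G → Bool) (r : ℕ)
                    (ε∉C : C (FiniteGroup.ε G) ≡ false) where
  open FiniteGroup G
  open IsGroup isGroup using (_//_)
  open CayleyGroup G C
  open GroupProperties group using (∙-cancelˡ; identityʳ-unique)

  Γ : Graph
  Γ = Cay (G ×R r) (C ∘ proj₁)

  open Graph Γ using (Adj)

  ~⇒Adj : ∀ {g h} → g ~ h → ∀ i j → Adj (g , i) (h , j)
  ~⇒Adj (g≢h , c , Cc , inj₁ gc≡h) i j =
    Cay-Adj⁺ (G ×R r) (C ∘ proj₁) (g≢h ∘ cong proj₁ , (c , j) , Cc , inj₁ (cong (_, j) gc≡h))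
  ~⇒Adj (g≢h , c , Cc , inj₂ hc≡g) i j =
    Cay-Adj⁺ (G ×R r) (C ∘ proj₁) (g≢h ∘ cong proj₁ , (c , i) , Cc , inj₂ (cong (_, i) hc≡g))

  Adj⇒~ᵣ : ∀ {g i h j} → Adj (g , i) (h , j) → g ~ h
  Adj⇒~ᵣ {g} {h = h} adj with Cay-Adj⁻ (G ×R r) (C ∘ proj₁) adj
  ... | _ , (c , _) , Cc , gc∨hc = g≢h , c , Cc , Sum.map (cong proj₁) (cong proj₁) gc∨hc
    where
    c≢ε : c ≢ ε
    c≢ε refl = case trans (sym Cc) ε∉C of λ ()

    g≢h : g ≢ h
    g≢h refl = c≢ε (identityʳ-unique g c (Sum.[ cong proj₁ , cong proj₁ ] gc∨hc))

  Adj-sym : ∀ {u v} → Adj u v → Adj v u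
  Adj-sym {_ , i} {_ , j} adj = ~⇒Adj (~-sym (Adj⇒~ᵣ adj)) j i

  loopless : ∀ {v} → ¬ Adj v v
  loopless adj = proj₁ (Adj⇒~ᵣ adj) refl

  triangle-projects : Triangle Γ → Triangle Γ₀
  triangle-projects ((g₁ , _) , (g₂ , _) , (g₃ , _) , a₁₂ , a₂₃ , a₃₁) =
    g₁ , g₂ , g₃ , ~⇒Adj₀ (Adj⇒~ᵣ a₁₂) , ~⇒Adj₀ (Adj⇒~ᵣ a₂₃) , ~⇒Adj₀ (Adj⇒~ᵣ a₃₁)

  -- Left translation by g // g₀ carries the neighbours of g₀ to neighbours of g, and each of
  -- them lifts to r neighbours of (g , i), one per layer of R_r.
  Degree≥⇒MinDegree : ∀ {g₀ m} → Degree≥ Γ₀ g₀ m → MinDegree Γ (m * r)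
  Degree≥⇒MinDegree {g₀} {m} (ns , (unique , adjacent) , m≤) (g , i) =
    cartesianProduct translated (allFin r) ,
    (cartesianProduct⁺ (map⁺ (∙-cancelˡ (g // g₀) _ _) unique) (allFin⁺ r) , adjacent′) ,
    subst (m * r ≤_) (sym length≡) (*-monoˡ-≤ r m≤)
    where
    translated = map ((g // g₀) ∙_) ns

    length≡ : length (cartesianProduct translated (allFin r)) ≡ length ns * r
    length≡ = trans (length-cartesianProduct translated (allFin r))
                    (cong₂ _*_ (length-map _ ns) (length-tabulate id))

    adjacent′ : ∀ {v} → v ∈ cartesianProduct translated (allFin r) → Adj (g , i) v
    adjacent′ {h , j} hj∈ with ∈-map⁻ _ (proj₁ (∈-cartesianProduct⁻ translated (allFin r) hj∈))
    ... | n , n∈ , refl = ~⇒Adj (~-translate-to g (Adj⇒~ (adjacent n∈))) i j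

proposition3p4 : (G : FiniteGroup) (C : FiniteGroup.Carrier G → Bool) (r : ℕ) →
    3 ≤ r → MinimalGenerating G C →
    HasK22Subdivision (Cay (asSemigroup G) C) →
    ¬ EmbeddableOnTorus (Cay (G ×R r) (λ p → C (proj₁ p)))
proposition3p4 G C r 3≤r minimal K22 (_ , R , euler) =
  Sum.[ triangle-impossible , long-faces-impossible ] triangle-or-numFaces*4≤N
  where
  open FiniteGroup G using (ε)
  open CayleyGroup G C
  open ProductGraph G C r (identity∉minimal minimal)
  open FaceTracing Γ R Adj-sym

  0<r : 0 < r
  0<r = ≤-trans (s≤s z≤n) 3≤r

  minDegree : MinDegree Γ (2 * r)
  minDegree = Degree≥⇒MinDegree (proj₂ (K22⇒Degree≥2 K22))

  open ShortFaces loopless (MinDegree-weaken Γ (*-monoʳ-≤ 2 0<r) minDegree)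

  0<V : 0 < length (vertices Γ)
  0<V = vertices-nonempty Γ (ε , fromℕ< 0<r)

  triangle-impossible : ¬ Triangle Γ
  triangle-impossible triangle =
    let _ , degree≥3 = K22×triangle⇒Degree≥3 K22 (triangle-projects triangle) in
    bound-fails-for-3-and-3r 3≤r (euler-torus-bound 3 (3 * r) euler numFaces*3≤N
      (vertices*m≤darts Γ (Degree≥⇒MinDegree degree≥3)) 0<V)

  long-faces-impossible : ¬ numFaces Γ R * 4 ≤ N
  long-faces-impossible numFaces*4≤N = bound-fails-for-4-and-2r 3≤r
    (euler-torus-bound 4 (2 * r) euler numFaces*4≤N (vertices*m≤darts Γ minDegree) 0<V)
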